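{- The function $d(G,H) := \Vert G\Vert^2 + \Vert H\Vert^2 - 2\,G.H$ is a metric on the set of isomorphism classes of simple graphs on $n$ vertices; that is, for all simple $n$-vertex graphs $G,H,G_1,G_2$: $d(G,H)\ge 0$; $d(G,H)=0$ if and only if $G\cong H$; and $d(G_1,G_2)\le d(G_1,H)+d(G_2,H)$.
   Context: For a simple graph $G$ on vertices $v_1,\dots,v_n$, $A_G$ is the $n\times n$ matrix with zero diagonal and, for $i\ne j$, $(A_G)_{ij}=+1$ if $v_i,v_j$ are adjacent and $-1$ otherwise. The dot product is $G.H := \max_P \operatorname{tr}(A_G P A_H P^T)$, the maximum over all $n\times n$ permutation matrices $P$, and $\Vert G\Vert = \sqrt{G.G}$. -}

module Defs where

open import Data.Nat using (ℕ; zero; suc)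
open import Data.Bool using (Bool; true; false; _∧_; if_then_else_)
open import Data.Fin using (Fin; zero; suc)
open import Data.Fin.Properties using (_≟_)
open import Data.Fin.Permutation using (Permutation; _⟨$⟩ʳ_)
open import Data.Integer using (ℤ; +_; -_; _+_; _*_; _-_; _⊔_)
open import Data.List using (List; []; _∷_; map; concatMap; foldr; filterᵇ; allFin)
open import Data.List as L using ()
open import Data.Vec using (Vec; []; _∷_; lookup)
open import Relation.Nullary.Decidable using (⌊_⌋)
open import Relation.Binary.PropositionalEquality using (_≡_)

record Graph (n : ℕ) : Set where
  field
    adj     : Fin n → Fin n → Bool
    adj-sym : ∀ i j → adj i j ≡ adj j i
    adj-irr : ∀ i → adj i i ≡ false
open Graph public

Matrix : ℕ → Set
Matrix n = Fin n → Fin n → ℤ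

∑ : (n : ℕ) → (Fin n → ℤ) → ℤ
∑ zero    f = + 0
∑ (suc n) f = f zero + ∑ n (λ i → f (suc i))

_·_ : ∀ {n} → Matrix n → Matrix n → Matrix n
_·_ {n} A B i j = ∑ n (λ k → A i k * B k j)

transpose : ∀ {n} → Matrix n → Matrix n
transpose A i j = A j i

tr : ∀ {n} → Matrix n → ℤ
tr {n} A = ∑ n (λ i → A i i)

A : ∀ {n} → Graph n → Matrix n
A G i j with ⌊ i ≟ j ⌋
... | true  = + 0
... | false = if adj G i j then + 1 else - (+ 1)

vecs : ∀ {n} (m : ℕ) → List (Vec (Fin n) m)
vecs {n} zero    = [] ∷ []
vecs {n} (suc m) = concatMap (λ x → map (x ∷_) (vecs m)) (allFin n)

andL : List Bool → Bool
andL = foldr _∧_ true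

injectiveᵇ : ∀ {n} → Vec (Fin n) n → Bool
injectiveᵇ {n} v =
  andL (concatMap (λ i → map (λ j → if ⌊ lookup v i ≟ lookup v j ⌋ then ⌊ i ≟ j ⌋ else true)
                             (allFin n)) (allFin n))

-- all permutations of Fin n (as image vectors; injective endofunctions of a finite set)
perms : (n : ℕ) → List (Vec (Fin n) n)
perms n = filterᵇ injectiveᵇ (vecs n)

permMatrix : ∀ {n} → Vec (Fin n) n → Matrix n
permMatrix σ i j = if ⌊ lookup σ i ≟ j ⌋ then + 1 else + 0

identityVec : (n : ℕ) → Vec (Fin n) n
identityVec n = Data.Vec.tabulate (λ i → i)
  where import Data.Vec

trTerm : ∀ {n} → Graph n → Graph n → Vec (Fin n) n → ℤ
trTerm G H σ = tr ((A G · (permMatrix σ · A H)) · transpose (permMatrix σ))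

-- G.H = max over all permutation matrices P of tr(A_G P A_H Pᵀ)
-- (the list of permutations is nonempty: it contains the identity, used as seed)
dot : ∀ {n} → Graph n → Graph n → ℤ
dot {n} G H = foldr _⊔_ (trTerm G H (identityVec n)) (map (trTerm G H) (perms n))

norm² : ∀ {n} → Graph n → ℤ
norm² G = dot G G

d : ∀ {n} → Graph n → Graph n → ℤ
d G H = norm² G + norm² H - (+ 2) * dot G H

_≅_ : ∀ {n} → Graph n → Graph n → Set
_≅_ {n} G H = Σ' (Permutation n n) (λ σ → ∀ i j → adj G i j ≡ adj H (σ ⟨$⟩ʳ i) (σ ⟨$⟩ʳ j))
  where open import Data.Product using () renaming (Σ to Σ')

-- Relabelling H by a permutation π of its vertices turns P A_H Pᵀ into the adjacency matrix of a graph H^π,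
-- so G.H is the largest Frobenius inner product ⟪A_G , A_{H^π}⟫. The polarisation identity
-- 2⟪M , N⟫ + ‖M − N‖² = ‖M‖² + ‖N‖², together with ‖A_{H^π}‖ = ‖A_H‖, then gives ‖G‖² = ‖A_G‖² and
-- d(G,H) = min_π ‖A_G − A_{H^π}‖². This minimum vanishes exactly when G = H^π for some π. For matrices with
-- zero diagonal and ±1 entries elsewhere the squared distance satisfies the triangle inequality entry by
-- entry, and composing optimal relabellings for (G₁,H) and (G₂,H) yields a relabelling of G₂ that
-- witnesses d(G₁,G₂) ≤ d(G₁,H) + d(G₂,H).

module Submission where

open import Defs
open import Data.Nat using (ℕ)
open import Data.Integer using (_≤_; _+_; +_)
open import Data.Product using (_×_)
open import Function.Bundles using (_⇔_)
open import Relation.Binary.PropositionalEquality using (_≡_; _≢_)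

open import Data.Nat using (zero; suc; z≤n)
open import Data.Bool using (Bool; true; false; T; if_then_else_)
open import Data.Bool.Properties using (T-∧)
open import Data.Fin using (Fin; zero; suc; punchOut)
open import Data.Fin.Permutation as Perm using (Permutation; _⟨$⟩ʳ_; _⟨$⟩ˡ_; _∘ₚ_; flip; permutation)
open import Data.Fin.Properties using (_≟_; any?; punchOut-injective; injective⇒≤)
open import Data.Integer using (ℤ; -_; _*_; _-_; _⊔_; +≤+; -[1+_])
import Data.Integer.Properties as ℤ
open import Data.Integer.Tactic.RingSolver using (solve-∀)
open import Data.List using (List; _∷_; map; foldr; allFin; concatMap)
open import Data.List.Membership.Propositional using (_∈_)
open import Data.List.Membership.Propositional.Properties
  using (∈-map⁺; ∈-map⁻; ∈-concatMap⁺; ∈-filter⁺; ∈-filter⁻; ∈-allFin; foldr-selective)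
open import Data.List.Relation.Unary.All using (All)
open import Data.List.Properties using (foldr-forcesᵇ; foldr-preservesᵇ)
import Data.List.Relation.Unary.All.Properties as All
open import Data.List.Relation.Unary.Any as Any using (here; there)
import Data.Nat.Properties as ℕ
open import Data.Product using (Σ; ∃; _,_; proj₁; proj₂)
open import Data.Sum using (inj₁; inj₂; [_,_]′)
open import Data.Unit using (tt)
open import Data.Vec as Vec using (Vec; lookup; tabulate)
open import Data.Vec.Properties using (lookup∘tabulate)
open import Function using (id; _∘_; case_of_; Injective)
open import Function.Bundles using (mk⇔; Equivalence)
import Algebra.Properties.Semiring.Sum as SemiringSum
open import Relation.Binary.PropositionalEquality
  using (refl; sym; trans; cong; cong₂; subst; module ≡-Reasoning)
open import Relation.Nullary using (Dec; yes; no; contradiction)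
open import Relation.Nullary.Decidable using (⌊_⌋; ⌊⌋-map′; T?)

private
  variable
    n : ℕ

  module ℤΣ = SemiringSum ℤ.+-*-semiring

∑≡sum : ∀ n (f : Fin n → ℤ) → ∑ n f ≡ ℤΣ.sum f
∑≡sum zero    f = refl
∑≡sum (suc n) f = cong (_+_ (f zero)) (∑≡sum n (f ∘ suc))

∑-cong : ∀ n {f g : Fin n → ℤ} → (∀ i → f i ≡ g i) → ∑ n f ≡ ∑ n g
∑-cong zero    f≗g = refl
∑-cong (suc n) f≗g = cong₂ _+_ (f≗g zero) (∑-cong n (f≗g ∘ suc))

∑-distrib-+ : ∀ n (f g : Fin n → ℤ) → ∑ n (λ i → f i + g i) ≡ ∑ n f + ∑ n g
∑-distrib-+ n f g = begin
  ∑ n (λ i → f i + g i)       ≡⟨ ∑≡sum n _ ⟩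
  ℤΣ.sum (λ i → f i + g i)    ≡⟨ ℤΣ.∑-distrib-+ f g ⟩
  ℤΣ.sum f + ℤΣ.sum g         ≡⟨ cong₂ _+_ (∑≡sum n f) (∑≡sum n g) ⟨
  ∑ n f + ∑ n g               ∎
  where open ≡-Reasoning

*-distribˡ-∑ : ∀ n c (f : Fin n → ℤ) → c * ∑ n f ≡ ∑ n (λ i → c * f i)
*-distribˡ-∑ n c f = begin
  c * ∑ n f                   ≡⟨ cong (c *_) (∑≡sum n f) ⟩
  c * ℤΣ.sum f                ≡⟨ ℤΣ.*-distribˡ-sum c f ⟩
  ℤΣ.sum (λ i → c * f i)      ≡⟨ ∑≡sum n _ ⟨
  ∑ n (λ i → c * f i)         ∎
  where open ≡-Reasoning

∑-permute : ∀ n (f : Fin n → ℤ) (π : Permutation n n) → ∑ n f ≡ ∑ n (λ i → f (π ⟨$⟩ʳ i))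
∑-permute n f π = begin
  ∑ n f                       ≡⟨ ∑≡sum n f ⟩
  ℤΣ.sum f                    ≡⟨ ℤΣ.∑-permute f π ⟩
  ℤΣ.sum (λ i → f (π ⟨$⟩ʳ i)) ≡⟨ ∑≡sum n _ ⟨
  ∑ n (λ i → f (π ⟨$⟩ʳ i))    ∎
  where open ≡-Reasoning

∑-zero : ∀ n {f : Fin n → ℤ} → (∀ i → f i ≡ + 0) → ∑ n f ≡ + 0
∑-zero zero    f≗0 = refl
∑-zero (suc n) f≗0 = cong₂ _+_ (f≗0 zero) (∑-zero n (f≗0 ∘ suc))

∑-mono-≤ : ∀ n {f g : Fin n → ℤ} → (∀ i → f i ≤ g i) → ∑ n f ≤ ∑ n g
∑-mono-≤ zero    f≤g = ℤ.≤-refl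
∑-mono-≤ (suc n) f≤g = ℤ.+-mono-≤ (f≤g zero) (∑-mono-≤ n (f≤g ∘ suc))

∑-nonneg : ∀ n {f : Fin n → ℤ} → (∀ i → + 0 ≤ f i) → + 0 ≤ ∑ n f
∑-nonneg zero    0≤f = ℤ.≤-refl
∑-nonneg (suc n) 0≤f = ℤ.+-mono-≤ (0≤f zero) (∑-nonneg n (0≤f ∘ suc))

+-nonneg-≡0 : ∀ {a b} → + 0 ≤ a → + 0 ≤ b → a + b ≡ + 0 → a ≡ + 0 × b ≡ + 0
+-nonneg-≡0 {a} {b} 0≤a 0≤b a+b≡0 = a≡0 , b≡0
  where
  open ℤ.≤-Reasoning
  a≡0 : a ≡ + 0
  a≡0 = ℤ.≤-antisym (begin
    a        ≡⟨ ℤ.+-identityʳ a ⟨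
    a + + 0  ≤⟨ ℤ.+-monoʳ-≤ a 0≤b ⟩
    a + b    ≡⟨ a+b≡0 ⟩
    + 0      ∎) 0≤a
  b≡0 : b ≡ + 0
  b≡0 = trans (sym (ℤ.+-identityˡ b)) (trans (cong (λ x → x + b) (sym a≡0)) a+b≡0)

∑-nonneg-≡0 : ∀ n {f : Fin n → ℤ} → (∀ i → + 0 ≤ f i) → ∑ n f ≡ + 0 → ∀ i → f i ≡ + 0
∑-nonneg-≡0 (suc n) 0≤f ∑≡0 = λ where
    zero    → proj₁ head-and-tail≡0
    (suc i) → ∑-nonneg-≡0 n (0≤f ∘ suc) (proj₂ head-and-tail≡0) i
  where head-and-tail≡0 = +-nonneg-≡0 (0≤f zero) (∑-nonneg n (0≤f ∘ suc)) ∑≡0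

-- Frobenius inner product of square matrices

∑² : (n : ℕ) → Matrix n → ℤ
∑² n F = ∑ n (λ i → ∑ n (F i))

∑²-cong : ∀ n {F G : Matrix n} → (∀ i k → F i k ≡ G i k) → ∑² n F ≡ ∑² n G
∑²-cong n F≗G = ∑-cong n (λ i → ∑-cong n (F≗G i))

∑²-distrib-+ : ∀ n (F G : Matrix n) → ∑² n (λ i k → F i k + G i k) ≡ ∑² n F + ∑² n G
∑²-distrib-+ n F G =
  trans (∑-cong n (λ i → ∑-distrib-+ n (F i) (G i))) (∑-distrib-+ n (λ i → ∑ n (F i)) (λ i → ∑ n (G i)))

*-distribˡ-∑² : ∀ n c (F : Matrix n) → c * ∑² n F ≡ ∑² n (λ i k → c * F i k)
*-distribˡ-∑² n c F =
  trans (*-distribˡ-∑ n c (λ i → ∑ n (F i))) (∑-cong n (λ i → *-distribˡ-∑ n c (F i)))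

∑²-permute : ∀ n (F : Matrix n) (π : Permutation n n) →
             ∑² n F ≡ ∑² n (λ i k → F (π ⟨$⟩ʳ i) (π ⟨$⟩ʳ k))
∑²-permute n F π =
  trans (∑-permute n (λ i → ∑ n (F i)) π) (∑-cong n (λ i → ∑-permute n (F (π ⟨$⟩ʳ i)) π))

∑²-zero : ∀ n {F : Matrix n} → (∀ i k → F i k ≡ + 0) → ∑² n F ≡ + 0
∑²-zero n F≗0 = ∑-zero n (λ i → ∑-zero n (F≗0 i))

∑²-mono-≤ : ∀ n {F G : Matrix n} → (∀ i k → F i k ≤ G i k) → ∑² n F ≤ ∑² n G
∑²-mono-≤ n F≤G = ∑-mono-≤ n (λ i → ∑-mono-≤ n (F≤G i))

∑²-nonneg : ∀ n {F : Matrix n} → (∀ i k → + 0 ≤ F i k) → + 0 ≤ ∑² n F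
∑²-nonneg n 0≤F = ∑-nonneg n (λ i → ∑-nonneg n (0≤F i))

∑²-nonneg-≡0 : ∀ n {F : Matrix n} → (∀ i k → + 0 ≤ F i k) → ∑² n F ≡ + 0 → ∀ i k → F i k ≡ + 0
∑²-nonneg-≡0 n 0≤F ∑²≡0 i =
  ∑-nonneg-≡0 n (0≤F i) (∑-nonneg-≡0 n (λ i → ∑-nonneg n (0≤F i)) ∑²≡0 i)

⟪_,_⟫ : Matrix n → Matrix n → ℤ
⟪_,_⟫ {n} M N = ∑² n (λ i k → M i k * N i k)

∥_∥² : Matrix n → ℤ
∥ M ∥² = ⟪ M , M ⟫

_⊖_ : Matrix n → Matrix n → Matrix n
(M ⊖ N) i k = M i k - N i k

square-nonneg : ∀ x → + 0 ≤ x * x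
square-nonneg (+ m)    = subst (+ 0 ≤_) (sym (ℤ.+◃n≡+n _)) (+≤+ z≤n)
square-nonneg -[1+ m ] = +≤+ z≤n

square≡0⇒≡0 : ∀ x → x * x ≡ + 0 → x ≡ + 0
square≡0⇒≡0 x x²≡0 = [ id , id ]′ (ℤ.i*j≡0⇒i≡0∨j≡0 x x²≡0)

∥∥²-nonneg : (M : Matrix n) → + 0 ≤ ∥ M ∥²
∥∥²-nonneg {n} M = ∑²-nonneg n (λ i k → square-nonneg (M i k))

∥⊖∥²≡0⇔≗ : (M N : Matrix n) → ∥ M ⊖ N ∥² ≡ + 0 ⇔ (∀ i k → M i k ≡ N i k)
∥⊖∥²≡0⇔≗ {n} M N = mk⇔ entries-equal norm-zero
  where
  entries-equal : ∥ M ⊖ N ∥² ≡ + 0 → ∀ i k → M i k ≡ N i k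
  entries-equal ∥M⊖N∥²≡0 i k = ℤ.i-j≡0⇒i≡j (M i k) (N i k) (square≡0⇒≡0 ((M ⊖ N) i k)
    (∑²-nonneg-≡0 n (λ i k → square-nonneg ((M ⊖ N) i k)) ∥M⊖N∥²≡0 i k))
  norm-zero : (∀ i k → M i k ≡ N i k) → ∥ M ⊖ N ∥² ≡ + 0
  norm-zero M≗N = ∑²-zero n (λ i k → cong (λ x → x * x)
    (trans (cong (_-_ (M i k)) (sym (M≗N i k))) (ℤ.+-inverseʳ (M i k))))

polarisation : (M N : Matrix n) → + 2 * ⟪ M , N ⟫ + ∥ M ⊖ N ∥² ≡ ∥ M ∥² + ∥ N ∥²
polarisation {n} M N = begin
  + 2 * ⟪ M , N ⟫ + ∥ M ⊖ N ∥²
    ≡⟨ cong (_+ ∥ M ⊖ N ∥²) (*-distribˡ-∑² n (+ 2) _) ⟩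
  ∑² n (λ i k → + 2 * (M i k * N i k)) + ∥ M ⊖ N ∥²
    ≡⟨ ∑²-distrib-+ n _ _ ⟨
  ∑² n (λ i k → + 2 * (M i k * N i k) + (M i k - N i k) * (M i k - N i k))
    ≡⟨ ∑²-cong n (λ i k → entrywise (M i k) (N i k)) ⟩
  ∑² n (λ i k → M i k * M i k + N i k * N i k)
    ≡⟨ ∑²-distrib-+ n _ _ ⟩
  ∥ M ∥² + ∥ N ∥²
    ∎
  where
  open ≡-Reasoning
  entrywise : ∀ a b → + 2 * (a * b) + (a - b) * (a - b) ≡ a * a + b * b
  entrywise = solve-∀

2⟪⟫≤∥∥²+∥∥² : (M N : Matrix n) → + 2 * ⟪ M , N ⟫ ≤ ∥ M ∥² + ∥ N ∥²
2⟪⟫≤∥∥²+∥∥² M N = begin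
  + 2 * ⟪ M , N ⟫                ≡⟨ ℤ.+-identityʳ _ ⟨
  + 2 * ⟪ M , N ⟫ + + 0          ≤⟨ ℤ.+-monoʳ-≤ (+ 2 * ⟪ M , N ⟫) (∥∥²-nonneg (M ⊖ N)) ⟩
  + 2 * ⟪ M , N ⟫ + ∥ M ⊖ N ∥²   ≡⟨ polarisation M N ⟩
  ∥ M ∥² + ∥ N ∥²                ∎
  where open ℤ.≤-Reasoning

δ : Fin n → Fin n → ℤ
δ x k = if ⌊ x ≟ k ⌋ then + 1 else + 0

∑-*-δ : ∀ n (h : Fin n → ℤ) x → ∑ n (λ k → h k * δ x k) ≡ h x
∑-*-δ (suc n) h zero = begin
  h zero * + 1 + ∑ n (λ k → h (suc k) * + 0)  ≡⟨ cong₂ _+_ (ℤ.*-identityʳ (h zero))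
                                                   (∑-zero n (λ k → ℤ.*-zeroʳ (h (suc k)))) ⟩
  h zero + + 0                                 ≡⟨ ℤ.+-identityʳ (h zero) ⟩
  h zero                                       ∎
  where open ≡-Reasoning
∑-*-δ (suc n) h (suc x) = begin
  h zero * + 0 + ∑ n (λ k → h (suc k) * δ (suc x) (suc k))
    ≡⟨ cong₂ _+_ (ℤ.*-zeroʳ (h zero)) (∑-cong n (λ k → cong (h (suc k) *_) δ-suc)) ⟩
  + 0 + ∑ n (λ k → h (suc k) * δ x k)
    ≡⟨ ℤ.+-identityˡ _ ⟩
  ∑ n (λ k → h (suc k) * δ x k)
    ≡⟨ ∑-*-δ n (h ∘ suc) x ⟩
  h (suc x)
    ∎
  where
  open ≡-Reasoning
  δ-suc : ∀ {k} → δ (suc x) (suc k) ≡ δ x k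
  δ-suc {k} = cong (λ b → if b then + 1 else + 0) (⌊⌋-map′ _ _ (x ≟ k))

∑-δ-* : ∀ n (h : Fin n → ℤ) x → ∑ n (λ k → δ x k * h k) ≡ h x
∑-δ-* n h x = trans (∑-cong n (λ k → ℤ.*-comm (δ x k) (h k))) (∑-*-δ n h x)

-- permMatrix v i j is δ (lookup v i) j by definition, so both products with it collapse.
tr-conj-permMatrix : (M N : Matrix n) (v : Vec (Fin n) n) →
  tr ((M · (permMatrix v · N)) · transpose (permMatrix v)) ≡
  ∑² n (λ i k → M i k * N (lookup v k) (lookup v i))
tr-conj-permMatrix {n} M N v = ∑-cong n λ i →
  trans (∑-*-δ n (λ j → (M · (permMatrix v · N)) i j) (lookup v i))
        (∑-cong n (λ k → cong (M i k *_) (∑-δ-* n (λ l → N l (lookup v i)) (lookup v k))))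

foldr-⊔-upper : ∀ e {x} {xs : List ℤ} → x ∈ xs → x ≤ foldr _⊔_ e xs
foldr-⊔-upper e                (here refl)  = ℤ.i≤i⊔j _ _
foldr-⊔-upper e {xs = y ∷ _}   (there x∈xs) = ℤ.i≤j⇒i≤k⊔j y (foldr-⊔-upper e x∈xs)

T-and⇔All : ∀ bs → T (andL bs) ⇔ All T bs
T-and⇔All bs = mk⇔ (foldr-forcesᵇ (λ x y → Equivalence.to (T-∧ {x})) true bs)
                   (foldr-preservesᵇ (λ Tx Ty → Equivalence.from T-∧ (Tx , Ty)) tt)

All-pairs⇔ : (f : Fin n → Fin n → Bool) →
  All T (concatMap (λ i → map (f i) (allFin n)) (allFin n)) ⇔ (∀ i j → T (f i j))
All-pairs⇔ {n} f = mk⇔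
  (λ all i j → All.tabulate⁻ (All.map⁻ (All.tabulate⁻ (All.map⁻ (All.concat⁻ all)) i)) j)
  (λ T-f → All.concat⁺ (All.map⁺ (All.tabulate⁺ (λ i → All.map⁺ (All.tabulate⁺ (T-f i))))))

T-implies⇔ : ∀ {a b} {P : Set a} {Q : Set b} (P? : Dec P) (Q? : Dec Q) →
             T (if ⌊ P? ⌋ then ⌊ Q? ⌋ else true) ⇔ (P → Q)
T-implies⇔ (yes p) (yes q) = mk⇔ (λ _ _ → q) (λ _ → tt)
T-implies⇔ (yes p) (no ¬q) = mk⇔ (λ ()) (λ p→q → ¬q (p→q p))
T-implies⇔ (no ¬p) Q?      = mk⇔ (λ _ p → contradiction p ¬p) (λ _ → tt)

T-injectiveᵇ⇔ : (v : Vec (Fin n) n) → T (injectiveᵇ v) ⇔ Injective _≡_ _≡_ (lookup v)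
T-injectiveᵇ⇔ {n} v = mk⇔
  (λ T-v {i} {j} → Equivalence.to (entry⇔ i j)
                     (Equivalence.to (All-pairs⇔ entry) (Equivalence.to (T-and⇔All _) T-v) i j))
  (λ inj → Equivalence.from (T-and⇔All _)
             (Equivalence.from (All-pairs⇔ entry) (λ i j → Equivalence.from (entry⇔ i j) inj)))
  where
  entry : Fin n → Fin n → Bool
  entry i j = if ⌊ lookup v i ≟ lookup v j ⌋ then ⌊ i ≟ j ⌋ else true
  entry⇔ : ∀ i j → T (entry i j) ⇔ (lookup v i ≡ lookup v j → i ≡ j)
  entry⇔ i j = T-implies⇔ (lookup v i ≟ lookup v j) (i ≟ j)

∈-vecs : ∀ m (v : Vec (Fin n) m) → v ∈ vecs m
∈-vecs zero    Vec.[]       = here refl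
∈-vecs (suc m) (x Vec.∷ v) =
  ∈-concatMap⁺ (λ x → map (x Vec.∷_) (vecs m))
    (Any.map (λ { refl → ∈-map⁺ (x Vec.∷_) (∈-vecs m v) }) (∈-allFin x))

injective⇒surjective : {f : Fin n → Fin n} → Injective _≡_ _≡_ f → ∀ y → ∃ λ x → f x ≡ y
-- A missed y could be punched out of the codomain, injecting Fin (suc n) into Fin n.
injective⇒surjective {suc n} {f} f-inj y with any? (λ x → f x ≟ y)
... | yes hit  = hit
... | no  miss = contradiction (injective⇒≤ punchOut-injective′) ℕ.1+n≰n
  where
  avoids : ∀ x → y ≢ f x
  avoids x y≡fx = miss (x , sym y≡fx)
  punchOut-injective′ : Injective _≡_ _≡_ (λ x → punchOut (avoids x))
  punchOut-injective′ {a} {b} eq = f-inj (punchOut-injective (avoids a) (avoids b) eq)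

⟨$⟩ʳ-injective : (π : Permutation n n) → Injective _≡_ _≡_ (π ⟨$⟩ʳ_)
⟨$⟩ʳ-injective π {i} {j} πi≡πj = begin
  i                     ≡⟨ Perm.inverseˡ π ⟨
  π ⟨$⟩ˡ (π ⟨$⟩ʳ i)     ≡⟨ cong (π ⟨$⟩ˡ_) πi≡πj ⟩
  π ⟨$⟩ˡ (π ⟨$⟩ʳ j)     ≡⟨ Perm.inverseˡ π ⟩
  j                     ∎
  where open ≡-Reasoning

injective⇒permutation : {f : Fin n → Fin n} → Injective _≡_ _≡_ f →
                        Σ (Permutation n n) (λ π → ∀ i → π ⟨$⟩ʳ i ≡ f i)
injective⇒permutation {f = f} f-inj =
  permutation f (proj₁ ∘ surj) (proj₂ ∘ surj) (λ x → f-inj (proj₂ (surj (f x)))) , λ i → refl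
  where surj = injective⇒surjective f-inj

∈-perms⁻ : {v : Vec (Fin n) n} → v ∈ perms n →
           Σ (Permutation n n) (λ π → ∀ i → π ⟨$⟩ʳ i ≡ lookup v i)
∈-perms⁻ {n} {v} v∈perms = injective⇒permutation
  (Equivalence.to (T-injectiveᵇ⇔ v) (proj₂ (∈-filter⁻ (T? ∘ injectiveᵇ) {xs = vecs n} v∈perms)))

∈-perms⁺ : (π : Permutation n n) → tabulate (π ⟨$⟩ʳ_) ∈ perms n
∈-perms⁺ {n} π = ∈-filter⁺ (T? ∘ injectiveᵇ) (∈-vecs n _)
  (Equivalence.from (T-injectiveᵇ⇔ (tabulate (π ⟨$⟩ʳ_))) λ {i} {j} eq → ⟨$⟩ʳ-injective π
    (trans (sym (lookup∘tabulate (π ⟨$⟩ʳ_) i)) (trans eq (lookup∘tabulate (π ⟨$⟩ʳ_) j))))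

-- Adjacency matrices and relabelled graphs

sign : Bool → ℤ
sign b = if b then + 1 else - (+ 1)

sign-injective : ∀ {x y} → sign x ≡ sign y → x ≡ y
sign-injective {true}  {true}  _ = refl
sign-injective {false} {false} _ = refl

sign-triangle : ∀ x y z →
  (sign x - sign y) * (sign x - sign y) ≤
  (sign x - sign z) * (sign x - sign z) + (sign y - sign z) * (sign y - sign z)
sign-triangle true  true  true  = +≤+ z≤n
sign-triangle true  true  false = +≤+ z≤n
sign-triangle false false true  = +≤+ z≤n
sign-triangle false false false = +≤+ z≤n
sign-triangle true  false true  = ℤ.≤-refl
sign-triangle true  false false = ℤ.≤-refl
sign-triangle false true  true  = ℤ.≤-refl
sign-triangle false true  false = ℤ.≤-refl

A-diagonal : (G : Graph n) (i : Fin n) → A G i i ≡ + 0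
A-diagonal G i with i ≟ i
... | yes _   = refl
... | no  i≢i = contradiction refl i≢i

A-off-diagonal : (G : Graph n) {i j : Fin n} → i ≢ j → A G i j ≡ sign (adj G i j)
A-off-diagonal G {i} {j} i≢j with i ≟ j
... | yes i≡j = contradiction i≡j i≢j
... | no  _   = refl

A-sym : (G : Graph n) (i j : Fin n) → A G i j ≡ A G j i
A-sym G i j = case i ≟ j of λ where
  (yes refl) → refl
  (no  i≢j)  → trans (A-off-diagonal G i≢j)
                 (trans (cong sign (adj-sym G i j)) (sym (A-off-diagonal G (i≢j ∘ sym))))

A-≡⇔adj-≡ : (G H : Graph n) (i j : Fin n) → A G i j ≡ A H i j ⇔ adj G i j ≡ adj H i j
A-≡⇔adj-≡ G H i j with i ≟ j
... | yes refl = mk⇔ (λ _ → trans (adj-irr G i) (sym (adj-irr H i))) (λ _ → refl)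
... | no  _    = mk⇔ sign-injective (cong sign)

A-triangle : (G H K : Graph n) (i j : Fin n) →
  (A G i j - A H i j) * (A G i j - A H i j) ≤
  (A G i j - A K i j) * (A G i j - A K i j) + (A H i j - A K i j) * (A H i j - A K i j)
A-triangle G H K i j with i ≟ j
... | yes refl = ℤ.≤-refl
... | no  _    = sign-triangle (adj G i j) (adj H i j) (adj K i j)

relabel : Permutation n n → Graph n → Graph n
relabel π H = record
  { adj     = λ i j → adj H (π ⟨$⟩ʳ i) (π ⟨$⟩ʳ j)
  ; adj-sym = λ i j → adj-sym H (π ⟨$⟩ʳ i) (π ⟨$⟩ʳ j)
  ; adj-irr = λ i → adj-irr H (π ⟨$⟩ʳ i)
  }

A-relabel : (π : Permutation n n) (H : Graph n) (i j : Fin n) →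
            A (relabel π H) i j ≡ A H (π ⟨$⟩ʳ i) (π ⟨$⟩ʳ j)
A-relabel π H i j = case i ≟ j of λ where
  (yes refl) → trans (A-diagonal (relabel π H) i) (sym (A-diagonal H (π ⟨$⟩ʳ i)))
  (no  i≢j)  → trans (A-off-diagonal (relabel π H) i≢j)
                     (sym (A-off-diagonal H (i≢j ∘ ⟨$⟩ʳ-injective π)))

∥A-relabel∥² : (π : Permutation n n) (H : Graph n) → ∥ A (relabel π H) ∥² ≡ ∥ A H ∥²
∥A-relabel∥² {n} π H =
  trans (∑²-cong n (λ i k → cong₂ _*_ (A-relabel π H i k) (A-relabel π H i k)))
        (sym (∑²-permute n (λ i k → A H i k * A H i k) π))

dist² : Graph n → Graph n → ℤ
dist² G H = ∥ A G ⊖ A H ∥²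

dist²-nonneg : (G H : Graph n) → + 0 ≤ dist² G H
dist²-nonneg G H = ∥∥²-nonneg (A G ⊖ A H)

dist²≡0⇔ : (G H : Graph n) → dist² G H ≡ + 0 ⇔ (∀ i j → adj G i j ≡ adj H i j)
dist²≡0⇔ G H = mk⇔
  (λ dist²≡0 i j → Equivalence.to (A-≡⇔adj-≡ G H i j) (Equivalence.to A-entries dist²≡0 i j))
  (λ adj≗ → Equivalence.from A-entries (λ i j → Equivalence.from (A-≡⇔adj-≡ G H i j) (adj≗ i j)))
  where A-entries = ∥⊖∥²≡0⇔≗ (A G) (A H)

dist²-triangle : (G H K : Graph n) → dist² G H ≤ dist² G K + dist² H K
dist²-triangle {n} G H K = begin
  dist² G H                                                  ≤⟨ ∑²-mono-≤ n (A-triangle G H K) ⟩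
  ∑² n (λ i j → (A G ⊖ A K) i j * (A G ⊖ A K) i j + (A H ⊖ A K) i j * (A H ⊖ A K) i j)
                                                             ≡⟨ ∑²-distrib-+ n _ _ ⟩
  dist² G K + dist² H K                                      ∎
  where open ℤ.≤-Reasoning

dist²-relabel : (π : Permutation n n) (G H : Graph n) → dist² (relabel π G) (relabel π H) ≡ dist² G H
dist²-relabel {n} π G H =
  trans (∑²-cong n (λ i k → cong₂ (λ a b → (a - b) * (a - b)) (A-relabel π G i k) (A-relabel π H i k)))
        (sym (∑²-permute n (λ i k → (A G ⊖ A H) i k * (A G ⊖ A H) i k) π))

dist²-congʳ : (G : Graph n) {H H′ : Graph n} → (∀ i j → A H i j ≡ A H′ i j) → dist² G H ≡ dist² G H′
dist²-congʳ {n} G A≗ = ∑²-cong n (λ i k → cong (λ b → (A G i k - b) * (A G i k - b)) (A≗ i k))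

-- d as a minimum over relabellings

trTerm≡⟪A,A-relabel⟫ : (G H : Graph n) (v : Vec (Fin n) n) (π : Permutation n n) →
                       (∀ i → π ⟨$⟩ʳ i ≡ lookup v i) → trTerm G H v ≡ ⟪ A G , A (relabel π H) ⟫
trTerm≡⟪A,A-relabel⟫ {n} G H v π π≗v =
  trans (tr-conj-permMatrix (A G) (A H) v) (∑²-cong n (λ i k → cong (A G i k *_) (begin
    A H (lookup v k) (lookup v i)   ≡⟨ A-sym H (lookup v k) (lookup v i) ⟩
    A H (lookup v i) (lookup v k)   ≡⟨ cong₂ (A H) (π≗v i) (π≗v k) ⟨
    A H (π ⟨$⟩ʳ i) (π ⟨$⟩ʳ k)       ≡⟨ A-relabel π H i k ⟨
    A (relabel π H) i k             ∎)))
  where open ≡-Reasoning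

dot-upper : (G H : Graph n) (π : Permutation n n) → ⟪ A G , A (relabel π H) ⟫ ≤ dot G H
dot-upper {n} G H π =
  subst (_≤ dot G H) (trTerm≡⟪A,A-relabel⟫ G H (tabulate (π ⟨$⟩ʳ_)) π (sym ∘ lookup∘tabulate (π ⟨$⟩ʳ_)))
        (foldr-⊔-upper _ (∈-map⁺ (trTerm G H) (∈-perms⁺ π)))

dot-attained : (G H : Graph n) → Σ (Permutation n n) (λ π → dot G H ≡ ⟪ A G , A (relabel π H) ⟫)
dot-attained {n} G H
  with foldr-selective ℤ.⊔-sel (trTerm G H (identityVec n)) (map (trTerm G H) (perms n))
... | inj₁ dot≡seed = Perm.id ,
  trans dot≡seed (trTerm≡⟪A,A-relabel⟫ G H (identityVec n) Perm.id (sym ∘ lookup∘tabulate id))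
... | inj₂ dot∈ with v , v∈perms , dot≡trTerm ← ∈-map⁻ (trTerm G H) dot∈
                 with π , π≗v ← ∈-perms⁻ v∈perms
  = π , trans dot≡trTerm (trTerm≡⟪A,A-relabel⟫ G H v π π≗v)

norm²≡∥A∥² : (G : Graph n) → norm² G ≡ ∥ A G ∥²
norm²≡∥A∥² G with π , dot≡ ← dot-attained G G = ℤ.≤-antisym
  (ℤ.*-cancelˡ-≤-pos _ _ (+ 2) (begin
    + 2 * dot G G                          ≡⟨ cong (+ 2 *_) dot≡ ⟩
    + 2 * ⟪ A G , A (relabel π G) ⟫        ≤⟨ 2⟪⟫≤∥∥²+∥∥² (A G) (A (relabel π G)) ⟩
    ∥ A G ∥² + ∥ A (relabel π G) ∥²        ≡⟨ cong (_+_ ∥ A G ∥²) (∥A-relabel∥² π G) ⟩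
    ∥ A G ∥² + ∥ A G ∥²                    ≡⟨ twice _ ⟩
    + 2 * ∥ A G ∥²                         ∎))
  (dot-upper G G Perm.id)
  where
  open ℤ.≤-Reasoning
  twice : ∀ x → x + x ≡ + 2 * x
  twice = solve-∀

d≡∥A∥²+∥A∥²-2dot : (G H : Graph n) → d G H ≡ ∥ A G ∥² + ∥ A H ∥² - + 2 * dot G H
d≡∥A∥²+∥A∥²-2dot G H = cong₂ (λ a b → a + b - + 2 * dot G H) (norm²≡∥A∥² G) (norm²≡∥A∥² H)

∥A∥²+∥A∥²-2⟪⟫≡dist² : (G H : Graph n) (π : Permutation n n) →
  ∥ A G ∥² + ∥ A H ∥² - + 2 * ⟪ A G , A (relabel π H) ⟫ ≡ dist² G (relabel π H)
∥A∥²+∥A∥²-2⟪⟫≡dist² G H π = begin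
  ∥ A G ∥² + ∥ A H ∥² - + 2 * ⟪ A G , A πH ⟫
    ≡⟨ cong (λ b → ∥ A G ∥² + b - + 2 * ⟪ A G , A πH ⟫) (∥A-relabel∥² π H) ⟨
  ∥ A G ∥² + ∥ A πH ∥² - + 2 * ⟪ A G , A πH ⟫
    ≡⟨ cong (_- + 2 * ⟪ A G , A πH ⟫) (polarisation (A G) (A πH)) ⟨
  + 2 * ⟪ A G , A πH ⟫ + dist² G πH - + 2 * ⟪ A G , A πH ⟫
    ≡⟨ cancel (+ 2 * ⟪ A G , A πH ⟫) (dist² G πH) ⟩
  dist² G πH
    ∎
  where
  open ≡-Reasoning
  πH = relabel π H
  cancel : ∀ x y → x + y - x ≡ y
  cancel = solve-∀

d-≤-dist² : (G H : Graph n) (π : Permutation n n) → d G H ≤ dist² G (relabel π H)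
d-≤-dist² G H π = begin
  d G H                                                  ≡⟨ d≡∥A∥²+∥A∥²-2dot G H ⟩
  ∥ A G ∥² + ∥ A H ∥² - + 2 * dot G H                    ≤⟨ ℤ.+-monoʳ-≤ (∥ A G ∥² + ∥ A H ∥²) (ℤ.neg-mono-≤
                                                              (ℤ.*-monoˡ-≤-nonNeg (+ 2) (dot-upper G H π))) ⟩
  ∥ A G ∥² + ∥ A H ∥² - + 2 * ⟪ A G , A (relabel π H) ⟫  ≡⟨ ∥A∥²+∥A∥²-2⟪⟫≡dist² G H π ⟩
  dist² G (relabel π H)                                  ∎
  where open ℤ.≤-Reasoning

d-attained : (G H : Graph n) → Σ (Permutation n n) (λ π → d G H ≡ dist² G (relabel π H))
d-attained G H with π , dot≡ ← dot-attained G H = π , (begin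
  d G H                                                  ≡⟨ d≡∥A∥²+∥A∥²-2dot G H ⟩
  ∥ A G ∥² + ∥ A H ∥² - + 2 * dot G H                    ≡⟨ cong (λ x → ∥ A G ∥² + ∥ A H ∥² - + 2 * x) dot≡ ⟩
  ∥ A G ∥² + ∥ A H ∥² - + 2 * ⟪ A G , A (relabel π H) ⟫  ≡⟨ ∥A∥²+∥A∥²-2⟪⟫≡dist² G H π ⟩
  dist² G (relabel π H)                                  ∎)
  where open ≡-Reasoning

d-nonneg : (G H : Graph n) → + 0 ≤ d G H
d-nonneg G H = let π , d≡ = d-attained G H in
  subst (+ 0 ≤_) (sym d≡) (dist²-nonneg G (relabel π H))

d≡0⇔≅ : (G H : Graph n) → d G H ≡ + 0 ⇔ G ≅ H
d≡0⇔≅ G H = mk⇔ iso (λ (π , G≗πH) → ℤ.≤-antisym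
    (ℤ.≤-trans (d-≤-dist² G H π) (ℤ.≤-reflexive (Equivalence.from (dist²≡0⇔ G (relabel π H)) G≗πH)))
    (d-nonneg G H))
  where
  iso : d G H ≡ + 0 → G ≅ H
  iso d≡0 = let π , d≡ = d-attained G H in
    π , Equivalence.to (dist²≡0⇔ G (relabel π H)) (trans (sym d≡) d≡0)

d-triangle : (G₁ G₂ H : Graph n) → d G₁ G₂ ≤ d G₁ H + d G₂ H
d-triangle G₁ G₂ H = begin
  d G₁ G₂                                                      ≤⟨ d-≤-dist² G₁ G₂ ρ ⟩
  dist² G₁ (relabel ρ G₂)                                      ≤⟨ dist²-triangle G₁ (relabel ρ G₂) (relabel σ H) ⟩
  dist² G₁ (relabel σ H) + dist² (relabel ρ G₂) (relabel σ H)  ≡⟨ cong (_+_ (dist² G₁ (relabel σ H))) ρG₂-vs-σH ⟩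
  dist² G₁ (relabel σ H) + dist² G₂ (relabel τ H)              ≡⟨ cong₂ _+_ d₁≡ d₂≡ ⟨
  d G₁ H + d G₂ H                                              ∎
  where
  open ℤ.≤-Reasoning
  σ = proj₁ (d-attained G₁ H)
  τ = proj₁ (d-attained G₂ H)
  d₁≡ = proj₂ (d-attained G₁ H)
  d₂≡ = proj₂ (d-attained G₂ H)
  -- ρ = τ⁻¹ ∘ σ places G₂ relative to the relabelling H^σ as G₂ sits relative to H^τ.
  ρ = σ ∘ₚ flip τ
  σH≗ρτH : ∀ i j → A (relabel σ H) i j ≡ A (relabel ρ (relabel τ H)) i j
  σH≗ρτH i j = begin-equality
    A (relabel σ H) i j                           ≡⟨ A-relabel σ H i j ⟩
    A H (σ ⟨$⟩ʳ i) (σ ⟨$⟩ʳ j)                     ≡⟨ cong₂ (A H) (Perm.inverseʳ τ) (Perm.inverseʳ τ) ⟨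
    A H (τ ⟨$⟩ʳ (ρ ⟨$⟩ʳ i)) (τ ⟨$⟩ʳ (ρ ⟨$⟩ʳ j))  ≡⟨ A-relabel τ H (ρ ⟨$⟩ʳ i) (ρ ⟨$⟩ʳ j) ⟨
    A (relabel τ H) (ρ ⟨$⟩ʳ i) (ρ ⟨$⟩ʳ j)         ≡⟨ A-relabel ρ (relabel τ H) i j ⟨
    A (relabel ρ (relabel τ H)) i j               ∎
  ρG₂-vs-σH : dist² (relabel ρ G₂) (relabel σ H) ≡ dist² G₂ (relabel τ H)
  ρG₂-vs-σH = trans (dist²-congʳ (relabel ρ G₂) σH≗ρτH) (dist²-relabel ρ G₂ (relabel τ H))

theorem1 : (n : ℕ) →
    (∀ (G H : Graph n) → + 0 ≤ d G H)
    × (∀ (G H : Graph n) → (d G H ≡ + 0) ⇔ (G ≅ H))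
    × (∀ (G₁ G₂ H : Graph n) → d G₁ G₂ ≤ d G₁ H + d G₂ H)
theorem1 n = d-nonneg , d≡0⇔≅ , d-triangle
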